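{- Let $T$ be an out-quadrangular tournament and let $v\in V(T)$. Let $W$ be the subtournament of $T$ induced on the vertex set $O(v)$. Then $W$ contains no vertex of out-degree $1$ (out-degree computed in $W$).
   Context: A tournament $T$ is a loopless digraph in which for each pair of distinct vertices exactly one of $(u,v)$, $(v,u)$ is an arc; $u\rightarrow v$ means $(u,v)$ is an arc. $O(v)=\{u:v\rightarrow u\}$. A digraph is out-quadrangular if $|O(u)\cap O(v)|\neq 1$ for all distinct vertices $u,v$. -}

module Defs where

open import Data.Nat using (ℕ)
open import Data.Fin using (Fin)
open import Data.Bool using (Bool; true; false; _∧_)
open import Data.List using (List; filter; length)
open import Data.List.Base using (allFin)
open import Data.Product using (_×_)
open import Data.Sum using (_⊎_)
open import Relation.Nullary using (¬_)
open import Relation.Binary.PropositionalEquality using (_≡_; _≢_)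
open import Relation.Nullary.Decidable using (Dec)
open import Data.Bool.Properties using (T?)
open import Data.Bool using (T)

Digraph : ℕ → Set
Digraph n = Fin n → Fin n → Bool

record IsTournament {n : ℕ} (arc : Digraph n) : Set where
  field
    loopless  : ∀ u → arc u u ≡ false
    total     : ∀ u v → u ≢ v → arc u v ≡ true ⊎ arc v u ≡ true
    antisym   : ∀ u v → arc u v ≡ true → arc v u ≡ false

countV : {n : ℕ} → (Fin n → Bool) → ℕ
countV {n} p = length (filter (λ w → T? (p w)) (allFin n))

commonOut : {n : ℕ} → Digraph n → Fin n → Fin n → ℕ
commonOut arc u v = countV (λ w → arc u w ∧ arc v w)

OutQuadrangular : {n : ℕ} → Digraph n → Set
OutQuadrangular arc = ∀ u v → u ≢ v → ¬ (commonOut arc u v ≡ 1)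

inducedOutDeg : {n : ℕ} → Digraph n → (Fin n → Bool) → Fin n → ℕ
inducedOutDeg arc S u = countV (λ w → S w ∧ arc u w)

Out : {n : ℕ} → Digraph n → Fin n → (Fin n → Bool)
Out arc v w = arc v w

{-# OPTIONS --safe #-}
module Submission where

open import Defs
open import Data.Nat using (ℕ)
open import Data.Fin using (Fin)
open import Data.Bool using (true)
open import Relation.Nullary using (¬_)
open import Relation.Binary.PropositionalEquality using (_≡_; _≢_; refl; trans; sym)

module _ {n : ℕ} {arc : Digraph n} (tournament : IsTournament arc) where
  open IsTournament tournament

  arc⇒≢ : ∀ {u v} → arc u v ≡ true → u ≢ v
  arc⇒≢ {u} u→u refl with trans (sym u→u) (loopless u)
  ... | ()

inducedOutDeg-Out≡commonOut : {n : ℕ} (arc : Digraph n) (v u : Fin n) →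
  inducedOutDeg arc (Out arc v) u ≡ commonOut arc v u
inducedOutDeg-Out≡commonOut arc v u = refl

theorem9 : {n : ℕ} (arc : Digraph n) → IsTournament arc → OutQuadrangular arc →
    (v : Fin n) → (u : Fin n) → Out arc v u ≡ true →
    ¬ (inducedOutDeg arc (Out arc v) u ≡ 1)
theorem9 arc tournament quadrangular v u v→u deg≡1 =
  quadrangular v u (arc⇒≢ tournament v→u)
    (trans (sym (inducedOutDeg-Out≡commonOut arc v u)) deg≡1)
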